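{- Let $n\ge 4$ be even and let $F_n=(V_n,A_n,w_n)$ be the Goldbach factorization graph. Let $\Gamma_n=\{v\in V_n:\exists u\in V_n,\ v+u=n\}$, let $\Xi_n\subseteq V_n$ be the set of all vertices reachable by a directed path from some vertex of $\Gamma_n$, and let $\Theta_n=\{v\in V_n:\exists e\in\mathbb{N},\ e\ge 2,\ v^e=n-v\}$. Then $F_n$ has an exceptional autonomous component if and only if $(V_n\setminus\Theta_n)\setminus(\Gamma_n\cup\Xi_n)\neq\emptyset$.
   Context: For an even integer $n\ge 4$, the Goldbach factorization graph is the directed weighted graph $F_n=(V_n,A_n,w_n)$ with vertex set $V_n=[2,n-2]\cap\mathbb{P}$ ($\mathbb{P}$ the set of primes), arc set $A_n=\{(s,t)\in V_n^2 : s \mid (n-t)\}$ (loops allowed), and weights $w_n((s,t))=\max\{e\ge 1: s^e\mid (n-t)\}$. An autonomous component of $F_n$ is a minimal (with respect to inclusion) nonempty subgraph of $F_n$ induced by a vertex set $U\subseteq V_n$ such that $(s,t)\notin A_n$ for every $s\in V_n\setminus U$ and $t\in U$. A Goldbach autonomous component (GAC) is an autonomous component induced by vertices $v_1,v_2\in V_n$ with $v_1+v_2=n$ (a single vertex if $v_1=v_2$). A trivial autonomous component (TAC) is an autonomous component induced by a single vertex that is not a GAC. An exceptional autonomous component (EAC) is an autonomous component that is neither a TAC nor a GAC. -}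

module Defs where

open import Data.Nat using (ℕ; _+_; _∸_; _^_; _≤_)
open import Data.Nat.Divisibility using (_∣_)
open import Data.Nat.Primality using (Prime)
open import Data.Bool using (Bool; true)
open import Data.Product using (_×_; ∃; ∃-syntax)
open import Data.Sum using (_⊎_)
open import Relation.Nullary using (¬_)
open import Relation.Binary.PropositionalEquality using (_≡_)
open import Relation.Binary.Construct.Closure.ReflexiveTransitive using (Star)
open import Function.Bundles using (_⇔_)

Vertex : ℕ → ℕ → Set
Vertex n v = Prime v × 2 ≤ v × v ≤ n ∸ 2

Arc : ℕ → ℕ → ℕ → Set
Arc n s t = Vertex n s × Vertex n t × s ∣ (n ∸ t)

VSet : Set
VSet = ℕ → Bool

_∈ˢ_ : ℕ → VSet → Set
v ∈ˢ U = U v ≡ true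

_⊆ˢ_ : VSet → VSet → Set
U ⊆ˢ W = ∀ v → v ∈ˢ U → v ∈ˢ W

NonemptyS : VSet → Set
NonemptyS U = ∃[ v ] (v ∈ˢ U)

InV : ℕ → VSet → Set
InV n U = ∀ v → v ∈ˢ U → Vertex n v

Closed : ℕ → VSet → Set
Closed n U = ∀ s t → Vertex n s → ¬ (s ∈ˢ U) → t ∈ˢ U → ¬ Arc n s t

-- autonomous component (identified with its vertex set U; the induced
-- subgraph is determined by U): minimal nonempty closed U ⊆ V_n
Autonomous : ℕ → VSet → Set
Autonomous n U =
  InV n U × NonemptyS U × Closed n U ×
  (∀ W → InV n W → NonemptyS W → Closed n W → W ⊆ˢ U → U ⊆ˢ W)

GAC : ℕ → VSet → Set
GAC n U = Autonomous n U ×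
  ∃[ v₁ ] ∃[ v₂ ] (Vertex n v₁ × Vertex n v₂ × v₁ + v₂ ≡ n ×
                   (∀ x → (x ∈ˢ U) ⇔ (x ≡ v₁ ⊎ x ≡ v₂)))

TAC : ℕ → VSet → Set
TAC n U = Autonomous n U ×
  (∃[ v ] (∀ x → (x ∈ˢ U) ⇔ (x ≡ v))) × ¬ GAC n U

EAC : ℕ → VSet → Set
EAC n U = Autonomous n U × ¬ TAC n U × ¬ GAC n U

HasEAC : ℕ → Set
HasEAC n = ∃[ U ] EAC n U

Γ : ℕ → ℕ → Set
Γ n v = Vertex n v × ∃[ u ] (Vertex n u × v + u ≡ n)

Ξ : ℕ → ℕ → Set
Ξ n v = Vertex n v × ∃[ g ] (Γ n g × Star (Arc n) g v)

Θ : ℕ → ℕ → Set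
Θ n v = Vertex n v × ∃[ e ] (2 ≤ e × v ^ e ≡ n ∸ v)

{-# OPTIONS --safe #-}
-- An arc s → t of F_n says that the prime s divides n − t, so a vertex set is closed exactly
-- when it contains every prime factor of n − t for each of its members t, and autonomous
-- components are the minimal nonempty closed sets.  For a Goldbach pair w + u = n the pair
-- {w, u} is closed, and for w ∈ Θ_n (n − w = w^e) the singleton {w} is closed; so an
-- autonomous component meeting Γ_n is a GAC, one meeting Θ_n is a TAC, and since a closed
-- set contains all ancestors of its members, an EAC also avoids Ξ_n.
-- Conversely the vertices outside Θ_n ∪ Γ_n ∪ Ξ_n form a closed set (a vertex of Θ_n only
-- has a loop), so if there is one, there is a minimal nonempty closed set W of vertices
-- outside Θ_n ∪ Γ_n.  W is no GAC, and if W = {w} then w is the only prime factor of n − w,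
-- i.e. n − w = w^e, where e = 1 puts w in Γ_n and e ≥ 2 puts it in Θ_n; so W is an EAC.
module Submission where

open import Defs
open import Data.Bool using (true)
open import Data.Fin using (Fin; zero; suc; toℕ; fromℕ<)
open import Data.Fin.Properties using (toℕ-fromℕ<; toℕ-injective; any?; all?)
open import Data.Fin.Subset using (Subset; _∈_; _∉_; _⊆_; Nonempty; ∣_∣)
open import Data.Fin.Subset.Properties using (_∈?_; nonempty?; anySubset?; p⊂q⇒∣p∣<∣q∣)
open import Data.List using ([]; _∷_; length)
open import Data.List.Membership.Propositional using () renaming (_∈_ to _∈ₗ_)
open import Data.List.Relation.Unary.All as All using (All; []; _∷_)
open import Data.Nat using (ℕ; zero; suc; _+_; _*_; _∸_; _^_; _≤_; _<_; _≤?_; _<?_; _≟_; z≤n; s≤s; NonZero; >-nonZero; nonTrivial⇒n>1)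
open import Data.Nat.Divisibility using (_∣_; _∣?_; ∣-refl; ∣⇒≤; ∣1⇒≡1; m∣m*n; ∣m+n∣m⇒∣n; ∣m∸n∣n⇒∣m)
open import Data.Nat.ListAction using (product)
open import Data.Nat.ListAction.Properties using (∈⇒∣product)
open import Data.Nat.Primality using (Prime; prime?; euclidsLemma; prime⇒irreducible; prime⇒nonTrivial; ¬prime[1])
open import Data.Nat.Primality.Factorisation using (factorise; module PrimeFactorisation)
open import Data.Nat.Properties
open import Data.Product using (_×_; _,_; proj₁; proj₂; ∃; ∃-syntax)
open import Data.Sum using (_⊎_; inj₁; inj₂; [_,_])
open import Data.Vec using (tabulate)
open import Data.Vec.Properties using (lookup∘tabulate; []=⇒lookup; lookup⇒[]=)
open import Function using (_∘_; _∘₂_)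
open import Function.Bundles using (_⇔_; mk⇔; Equivalence)
open Equivalence using (to; from)
open import Level using (Level)
open import Relation.Binary.Construct.Closure.ReflexiveTransitive using (Star; ε; _◅_; _◅◅_)
open import Relation.Binary.PropositionalEquality using (_≡_; refl; sym; trans; cong; subst)
open import Relation.Nullary using (¬_; Dec; yes; no; does)
open import Relation.Nullary.Decidable using (_×-dec_; _⊎-dec_; _→-dec_; ¬?; map′; dec-true; decidable-stable; ¬¬-excluded-middle)
open import Relation.Nullary.Negation using (contradiction; ¬¬-map)
open import Relation.Unary using (Pred; Decidable)
import Data.Bool.Properties as Bool

private
  variable
    ℓ : Level
    m p s t u v w x : ℕ
    U S : VSet

prime∣prime⇒≡ : Prime p → Prime s → p ∣ s → p ≡ s
prime∣prime⇒≡ pp ps p∣s with prime⇒irreducible ps p∣s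
... | inj₁ refl = contradiction pp ¬prime[1]
... | inj₂ p≡s = p≡s

prime∣^⇒≡ : Prime p → Prime s → ∀ e → p ∣ s ^ e → p ≡ s
prime∣^⇒≡ pp ps zero p∣1 = contradiction (subst Prime (∣1⇒≡1 p∣1) pp) ¬prime[1]
prime∣^⇒≡ {s = s} pp ps (suc e) p∣s^1+e with euclidsLemma s (s ^ e) pp p∣s^1+e
... | inj₁ p∣s = prime∣prime⇒≡ pp ps p∣s
... | inj₂ p∣s^e = prime∣^⇒≡ pp ps e p∣s^e

product-replicate : ∀ xs → All (_≡ w) xs → product xs ≡ w ^ length xs
product-replicate [] [] = refl
product-replicate (x ∷ xs) (refl ∷ xs≡w) = cong (x *_) (product-replicate xs xs≡w)

soleFactor⇒power : ∀ m .{{_ : NonZero m}} → (∀ p → Prime p → p ∣ m → p ≡ w) →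
                   ∃[ e ] w ^ e ≡ m
soleFactor⇒power {w} m sole =
  length factors , sym (trans isFactorisation (product-replicate factors (All.tabulate factor≡w)))
  where
  open PrimeFactorisation (factorise m)
  factor≡w : ∀ {p} → p ∈ₗ factors → p ≡ w
  factor≡w p∈ = sole _ (All.lookup factorsPrime p∈)
                  (subst (_ ∣_) (sym isFactorisation) (∈⇒∣product p∈))

n<m^n : 1 < m → ∀ n → n < m ^ n
n<m^n 1<m zero = s≤s z≤n
n<m^n {m} 1<m (suc n) = ≤-<-trans (n<m^n 1<m n) (^-monoʳ-< m 1<m (n<1+n n))

∣m∣m∸n⇒∣n : ∀ {d m n} → n ≤ m → d ∣ m → d ∣ m ∸ n → d ∣ n
∣m∣m∸n⇒∣n {d} n≤m d∣m d∣m∸n = ∣m+n∣m⇒∣n (subst (d ∣_) (sym (m∸n+n≡m n≤m)) d∣m) d∣m∸n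

+≡⇒∸≡ : ∀ {n} → w + u ≡ n → n ∸ w ≡ u
+≡⇒∸≡ {w} {u} refl = m+n∸m≡n w u

vertex+2≤n : ∀ n {x} → Vertex n x → x + 2 ≤ n
vertex+2≤n zero       (_ , 2≤x , x≤0) = contradiction (≤-trans 2≤x x≤0) λ ()
vertex+2≤n (suc zero) (_ , 2≤x , x≤0) = contradiction (≤-trans 2≤x x≤0) λ ()
vertex+2≤n (suc (suc n)) {x} (_ , _ , x≤n) = m≤o∸n⇒m+n≤o x (s≤s (s≤s z≤n)) x≤n

does⇔ : {A : Set ℓ} (a? : Dec A) → does a? ≡ true ⇔ A
does⇔ a? = mk⇔ (from-does a?) (dec-true a?)
  where
  from-does : (a? : Dec _) → does a? ≡ true → _
  from-does (yes a) _ = a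

decSet : {P : Pred ℕ ℓ} → Decidable P → VSet
decSet P? x = does (P? x)

∈-decSet : {P : Pred ℕ ℓ} (P? : Decidable P) → x ∈ˢ decSet P? ⇔ P x
∈-decSet {x = x} P? = does⇔ (P? x)

∈ˢ-stable : ∀ U → ¬ ¬ (x ∈ˢ U) → x ∈ˢ U
∈ˢ-stable {x = x} U = decidable-stable (U x Bool.≟ true)

-- Opaque, so that unification recovers w and u from membership goals.
opaque
  singletonˢ : ℕ → VSet
  singletonˢ w = decSet (_≟ w)

  ∈-singletonˢ : ∀ {x w} → x ∈ˢ singletonˢ w ⇔ x ≡ w
  ∈-singletonˢ {w = w} = ∈-decSet (_≟ w)

  pairˢ : ℕ → ℕ → VSet
  pairˢ w u = decSet (λ x → x ≟ w ⊎-dec x ≟ u)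

  ∈-pairˢ : ∀ {x w u} → x ∈ˢ pairˢ w u ⇔ (x ≡ w ⊎ x ≡ u)
  ∈-pairˢ {w = w} {u} = ∈-decSet (λ x → x ≟ w ⊎-dec x ≟ u)

decSubset : {P : Pred (Fin m) ℓ} → Decidable P → Subset m
decSubset P? = tabulate (does ∘ P?)

∈-decSubset : {P : Pred (Fin m) ℓ} (P? : Decidable P) {i : Fin m} → i ∈ decSubset P? ⇔ P i
∈-decSubset P? {i} = mk⇔
  (to (does⇔ (P? i)) ∘ trans (sym (lookup∘tabulate (does ∘ P?) i)) ∘ []=⇒lookup)
  (λ pi → lookup⇒[]= i _ (trans (lookup∘tabulate (does ∘ P?) i) (from (does⇔ (P? i)) pi)))

opaque
  toVSet : Subset m → VSet
  toVSet W = decSet (λ x → any? (λ i → i ∈? W ×-dec toℕ i ≟ x))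

  ∈-toVSet : ∀ {W : Subset m} {x} → x ∈ˢ toVSet W ⇔ (∃[ i ] (i ∈ W × toℕ i ≡ x))
  ∈-toVSet {W = W} = ∈-decSet (λ x → any? (λ i → i ∈? W ×-dec toℕ i ≟ x))

toℕ-∈-toVSet : ∀ {W : Subset m} {i} → toℕ i ∈ˢ toVSet W ⇔ i ∈ W
toℕ-∈-toVSet = mk⇔
  (λ i∈ → let (j , j∈W , j≡i) = to ∈-toVSet i∈ in subst (_∈ _) (toℕ-injective j≡i) j∈W)
  (λ i∈W → from ∈-toVSet (_ , i∈W , refl))

opaque
  fromVSet : VSet → Subset m
  fromVSet W = decSubset (λ i → W (toℕ i) Bool.≟ true)

  ∈-fromVSet : ∀ {W} {i : Fin m} → i ∈ fromVSet W ⇔ toℕ i ∈ˢ W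
  ∈-fromVSet {W = W} = ∈-decSubset (λ i → W (toℕ i) Bool.≟ true)

¬¬-decidable : ∀ m (P : Pred (Fin m) ℓ) → ¬ ¬ (∀ i → Dec (P i))
¬¬-decidable zero    P ¬dec = ¬dec λ ()
¬¬-decidable (suc m) P ¬dec = ¬¬-excluded-middle λ dec₀ →
  ¬¬-decidable m (P ∘ suc) λ dec → ¬dec λ { zero → dec₀ ; (suc i) → dec i }

module _ {P : Pred (Subset m) ℓ} (P? : Decidable P) where

  smallest : ∀ b W → ∣ W ∣ ≤ b → P W → ∃[ W₀ ] (P W₀ × ∀ W → P W → ∣ W₀ ∣ ≤ ∣ W ∣)
  smallest zero W ∣W∣≤0 pW = W , pW , λ _ _ → ≤-trans ∣W∣≤0 z≤n
  smallest (suc b) W ∣W∣≤1+b pW with anySubset? (λ W′ → P? W′ ×-dec ∣ W′ ∣ <? ∣ W ∣)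
  ... | yes (W′ , pW′ , smaller) = smallest b W′ (≤-pred (≤-trans smaller ∣W∣≤1+b)) pW′
  ... | no ¬smaller = W , pW , λ W′ pW′ → ≮⇒≥ (λ smaller → ¬smaller (W′ , pW′ , smaller))

  ⊆-minimal : ∀ {W} → P W → ∃[ W₀ ] (P W₀ × ∀ W → P W → W ⊆ W₀ → W₀ ⊆ W)
  ⊆-minimal pW with smallest _ _ ≤-refl pW
  ... | W₀ , pW₀ , least = W₀ , pW₀ , λ W pW W⊆W₀ {i} i∈W₀ →
    decidable-stable (i ∈? W) λ i∉W → <⇒≱ (p⊂q⇒∣p∣<∣q∣ (W⊆W₀ , i , i∈W₀ , i∉W)) (least W pW)

module _ (n : ℕ) where

  vertex<n : Vertex n x → x < n
  vertex<n {x} vx = <-≤-trans (m<m+n x (s≤s z≤n)) (vertex+2≤n n vx)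

  2≤n∸vertex : Vertex n x → 2 ≤ n ∸ x
  2≤n∸vertex {x} vx = m+n≤o⇒m≤o∸n 2 (subst (_≤ n) (+-comm x 2) (vertex+2≤n n vx))

  Vertex? : ∀ x → Dec (Vertex n x)
  Vertex? x = prime? x ×-dec (2 ≤? x ×-dec x ≤? n ∸ 2)

  Arc? : ∀ s t → Dec (Arc n s t)
  Arc? s t = Vertex? s ×-dec Vertex? t ×-dec s ∣? n ∸ t

  primeFactor-vertex : Prime s → s ∣ n ∸ t → Vertex n t → Vertex n s
  primeFactor-vertex {s} ps s∣n∸t vt@(_ , 2≤t , _) =
    ps , nonTrivial⇒n>1 s {{prime⇒nonTrivial ps}} ,
    ≤-trans (∣⇒≤ {{>-nonZero (≤-trans (s≤s z≤n) (2≤n∸vertex vt))}} s∣n∸t) (∸-monoʳ-≤ n 2≤t)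

  primeFactor-arc : Prime s → s ∣ n ∸ t → Vertex n t → Arc n s t
  primeFactor-arc ps s∣n∸t vt = primeFactor-vertex ps s∣n∸t vt , vt , s∣n∸t

  complement-vertex⇒Γ : Vertex n x → Vertex n (n ∸ x) → Γ n x
  complement-vertex⇒Γ {x} vx vn∸x = vx , n ∸ x , vn∸x , m+[n∸m]≡n (<⇒≤ (vertex<n {x} vx))

  Γ⇒complement-vertex : Γ n x → Vertex n (n ∸ x)
  Γ⇒complement-vertex (_ , _ , vu , x+u≡n) = subst (Vertex n) (sym (+≡⇒∸≡ x+u≡n)) vu

  Γ? : ∀ x → Dec (Γ n x)
  Γ? x = map′ (λ (vx , vn∸x) → complement-vertex⇒Γ vx vn∸x)
              (λ γ → proj₁ γ , Γ⇒complement-vertex γ)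
              (Vertex? x ×-dec Vertex? (n ∸ x))

  Θ? : ∀ x → Dec (Θ n x)
  Θ? x with Vertex? x
  ... | no ¬vx = no (¬vx ∘ proj₁)
  ... | yes vx@(_ , 2≤x , _) =
    -- x ^ e ≡ n ∸ x forces e < x ^ e = n ∸ x, so the search for e is bounded.
    map′ (λ (e , _ , power) → vx , e , power)
         (λ (_ , e , power@(_ , x^e≡n∸x)) → e , subst (e <_) x^e≡n∸x (n<m^n 2≤x e) , power)
         (anyUpTo? (λ e → 2 ≤? e ×-dec x ^ e ≟ n ∸ x) (n ∸ x))

  Θ-primeFactor : Θ n w → Prime p → p ∣ n ∸ w → p ≡ w
  Θ-primeFactor ((pw , _) , e , _ , w^e≡n∸w) pp p∣n∸w =
    prime∣^⇒≡ pp pw e (subst (_ ∣_) (sym w^e≡n∸w) p∣n∸w)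

  Θ-loopsOnly : Θ n s → Arc n s t → t ≡ s
  Θ-loopsOnly {s = s} (vs , suc e , _ , s^1+e≡n∸s) (_ , vt@(pt , _) , s∣n∸t) =
    sym (prime∣prime⇒≡ (proj₁ vs) pt (∣m∣m∸n⇒∣n (<⇒≤ (vertex<n vt)) s∣n s∣n∸t))
    where
    s∣n : s ∣ n
    s∣n = ∣m∸n∣n⇒∣m s (<⇒≤ (vertex<n vs)) (subst (s ∣_) s^1+e≡n∸s (m∣m*n (s ^ e))) ∣-refl

  Goldbach-primeFactor : Prime u → w + u ≡ n → Prime p → p ∣ n ∸ w → p ≡ u
  Goldbach-primeFactor pu w+u≡n pp p∣n∸w =
    prime∣prime⇒≡ pp pu (subst (_ ∣_) (+≡⇒∸≡ w+u≡n) p∣n∸w)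

  soleFactor⇒Γ⊎Θ : Vertex n w → (∀ p → Prime p → p ∣ n ∸ w → p ≡ w) → Γ n w ⊎ Θ n w
  soleFactor⇒Γ⊎Θ {w} vw sole
    with soleFactor⇒power (n ∸ w) {{>-nonZero (≤-trans (s≤s z≤n) (2≤n∸vertex vw))}} sole
  ... | zero , 1≡n∸w = contradiction (subst (2 ≤_) (sym 1≡n∸w) (2≤n∸vertex vw)) λ { (s≤s ()) }
  ... | suc zero , w*1≡n∸w =
    inj₁ (complement-vertex⇒Γ vw (subst (Vertex n) (trans (sym (*-identityʳ w)) w*1≡n∸w) vw))
  ... | suc (suc e) , w^e≡n∸w = inj₂ (vw , suc (suc e) , s≤s (s≤s z≤n) , w^e≡n∸w)

  closed⇒pred∈ : Closed n U → t ∈ˢ U → Arc n s t → s ∈ˢ U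
  closed⇒pred∈ {U = U} closed t∈U a = ∈ˢ-stable U λ s∉U → closed _ _ (proj₁ a) s∉U t∈U a

  closed⇒ancestor∈ : Closed n U → t ∈ˢ U → Star (Arc n) s t → s ∈ˢ U
  closed⇒ancestor∈ closed t∈U ε = t∈U
  closed⇒ancestor∈ closed t∈U (a ◅ path) = closed⇒pred∈ closed (closed⇒ancestor∈ closed t∈U path) a

  closed⇒primeFactor∈ : Closed n U → Vertex n t → t ∈ˢ U → Prime p → p ∣ n ∸ t → p ∈ˢ U
  closed⇒primeFactor∈ closed vt t∈U pp p∣n∸t = closed⇒pred∈ closed t∈U (primeFactor-arc pp p∣n∸t vt)

  primeFactors∈⇒closed : (∀ {p t} → Prime p → t ∈ˢ S → p ∣ n ∸ t → p ∈ˢ S) → Closed n S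
  primeFactors∈⇒closed factors∈ _ _ _ s∉S t∈S ((ps , _) , _ , s∣n∸t) = s∉S (factors∈ ps t∈S s∣n∸t)

  Goldbach-pair-closed : Prime w → Prime u → w + u ≡ n → Closed n (pairˢ w u)
  Goldbach-pair-closed {w} {u} pw pu w+u≡n = primeFactors∈⇒closed λ pp t∈ p∣n∸t →
    from ∈-pairˢ
      ([ (λ { refl → inj₂ (Goldbach-primeFactor pu w+u≡n pp p∣n∸t) })
       , (λ { refl → inj₁ (Goldbach-primeFactor pw (trans (+-comm u w) w+u≡n) pp p∣n∸t) })
       ] (to ∈-pairˢ t∈))

  Θ-singleton-closed : Θ n w → Closed n (singletonˢ w)
  Θ-singleton-closed {w} θ = primeFactors∈⇒closed λ {p} pp t∈ p∣n∸t →
    from ∈-singletonˢ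
      (Θ-primeFactor θ pp (subst (λ t → p ∣ n ∸ t) (to ∈-singletonˢ t∈) p∣n∸t))

  Exceptional : ℕ → Set
  Exceptional v = Vertex n v × ¬ Θ n v × ¬ Γ n v × ¬ Ξ n v

  autonomous-Γ∈⇒GAC : Autonomous n U → w ∈ˢ U → Γ n w → GAC n U
  autonomous-Γ∈⇒GAC {U} {w} aut@(_ , _ , closed , minimal) w∈U (vw , u , vu , w+u≡n) =
    aut , w , u , vw , vu , w+u≡n , λ x → mk⇔ (to ∈-pairˢ ∘ U⊆pair x) (pair⊆U x)
    where
    u∈U : u ∈ˢ U
    u∈U = closed⇒pred∈ closed w∈U (vu , vw , subst (u ∣_) (sym (+≡⇒∸≡ w+u≡n)) ∣-refl)
    pair⊆U : ∀ x → x ≡ w ⊎ x ≡ u → x ∈ˢ U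
    pair⊆U _ (inj₁ refl) = w∈U
    pair⊆U _ (inj₂ refl) = u∈U
    pair-vertices : InV n (pairˢ w u)
    pair-vertices x x∈ = [ (λ { refl → vw }) , (λ { refl → vu }) ] (to ∈-pairˢ x∈)
    U⊆pair : U ⊆ˢ pairˢ w u
    U⊆pair = minimal (pairˢ w u) pair-vertices (w , from ∈-pairˢ (inj₁ refl))
               (Goldbach-pair-closed (proj₁ vw) (proj₁ vu) w+u≡n) (λ x → pair⊆U x ∘ to ∈-pairˢ)

  autonomous-Θ∈⇒TAC : Autonomous n U → ¬ GAC n U → w ∈ˢ U → Θ n w → TAC n U
  autonomous-Θ∈⇒TAC {U} {w} aut@(_ , _ , _ , minimal) ¬gac w∈U θ@(vw , _) =
    aut , (w , λ x → mk⇔ (to ∈-singletonˢ ∘ U⊆singleton x) (singleton⊆U x)) , ¬gac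
    where
    singleton⊆U : ∀ x → x ≡ w → x ∈ˢ U
    singleton⊆U _ refl = w∈U
    U⊆singleton : U ⊆ˢ singletonˢ w
    U⊆singleton = minimal (singletonˢ w) (λ x x∈ → subst (Vertex n) (sym (to ∈-singletonˢ x∈)) vw)
                    (w , from ∈-singletonˢ refl) (Θ-singleton-closed θ)
                    (λ x → singleton⊆U x ∘ to ∈-singletonˢ)

  EAC-member-exceptional : EAC n U → w ∈ˢ U → Exceptional w
  EAC-member-exceptional {U} {w} (aut@(vertices , _ , closed , _) , ¬tac , ¬gac) w∈U =
    vertices w w∈U , ¬Θ w∈U , ¬Γ w∈U , ¬Ξ
    where
    ¬Γ : ∀ {x} → x ∈ˢ U → ¬ Γ n x
    ¬Γ x∈U γ = ¬gac (autonomous-Γ∈⇒GAC aut x∈U γ)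
    ¬Θ : ∀ {x} → x ∈ˢ U → ¬ Θ n x
    ¬Θ x∈U θ = ¬tac (autonomous-Θ∈⇒TAC aut ¬gac x∈U θ)
    ¬Ξ : ¬ Ξ n w
    ¬Ξ (_ , g , γ , path) = ¬Γ (closed⇒ancestor∈ closed w∈U path) γ

  HasEAC⇒exceptional : HasEAC n → ∃[ v ] Exceptional v
  HasEAC⇒exceptional (U , eac@((_ , (v , v∈U) , _) , _)) = v , EAC-member-exceptional eac v∈U

  exceptional-pred : Exceptional t → Arc n s t → Exceptional s
  exceptional-pred (vt , ¬Θt , _ , ¬Ξt) a@(vs , _) =
    vs ,
    (λ θ → ¬Θt (subst (Θ n) (sym (Θ-loopsOnly θ a)) θ)) ,
    (λ γ → ¬Ξt (vt , _ , γ , a ◅ ε)) ,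
    (λ (_ , g , γ , path) → ¬Ξt (vt , g , γ , path ◅◅ (a ◅ ε)))

  Admissible : ℕ → Set
  Admissible x = Vertex n x × ¬ Θ n x × ¬ Γ n x

  Admissible? : ∀ x → Dec (Admissible x)
  Admissible? x = Vertex? x ×-dec ¬? (Θ? x) ×-dec ¬? (Γ? x)

  autonomous-admissible⇒EAC : Autonomous n U → (∀ x → x ∈ˢ U → Admissible x) → EAC n U
  autonomous-admissible⇒EAC {U} aut@(_ , _ , closed , _) admissible = aut , ¬TAC , ¬GAC
    where
    ¬GAC : ¬ GAC n U
    ¬GAC (_ , v₁ , v₂ , _ , vv₂ , v₁+v₂≡n , U≡pair) with admissible v₁ (from (U≡pair v₁) (inj₁ refl))
    ... | vv₁ , _ , ¬Γv₁ = ¬Γv₁ (vv₁ , v₂ , vv₂ , v₁+v₂≡n)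
    ¬TAC : ¬ TAC n U
    ¬TAC (_ , (w , U≡singleton) , _) with from (U≡singleton w) refl
    ... | w∈U with admissible w w∈U
    ... | vw , ¬Θw , ¬Γw = [ ¬Γw , ¬Θw ] (soleFactor⇒Γ⊎Θ vw λ p pp p∣n∸w →
      to (U≡singleton p) (closed⇒primeFactor∈ closed vw w∈U pp p∣n∸w))

  index : Vertex n x → Fin n
  index vx = fromℕ< (vertex<n vx)

  toℕ-index : (vx : Vertex n x) → toℕ (index vx) ≡ x
  toℕ-index vx = toℕ-fromℕ< (vertex<n vx)

  Candidate : Subset n → Set
  Candidate W = (∀ i → i ∈ W → Admissible (toℕ i)) × Nonempty W ×
                (∀ s t → s ∉ W → t ∈ W → ¬ Arc n (toℕ s) (toℕ t))

  Candidate? : Decidable Candidate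
  Candidate? W = all? (λ i → i ∈? W →-dec Admissible? (toℕ i)) ×-dec nonempty? W ×-dec
                 all? (λ s → all? (λ t → ¬? (s ∈? W) →-dec (t ∈? W →-dec ¬? (Arc? (toℕ s) (toℕ t)))))

  exceptional⇒candidate : Exceptional v → ∃ Candidate
  -- Ξ n is not decided here: the search for a candidate is decidable, and refuting its
  -- failure only needs Exceptional to be decided on the finitely many i : Fin n.
  exceptional⇒candidate ev = decidable-stable (anySubset? Candidate?)
    (¬¬-map (λ dec → decSubset dec , exceptionalSet-candidate dec)
            (¬¬-decidable n (Exceptional ∘ toℕ)))
    where
    exceptionalSet-candidate : (dec : ∀ i → Dec (Exceptional (toℕ i))) → Candidate (decSubset dec)
    exceptionalSet-candidate dec =
      (λ i i∈ → let (vi , ¬Θi , ¬Γi , _) = to (∈-decSubset dec) i∈ in vi , ¬Θi , ¬Γi) ,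
      (index (proj₁ ev) ,
       from (∈-decSubset dec) (subst Exceptional (sym (toℕ-index (proj₁ ev))) ev)) ,
      λ s t s∉ t∈ a → s∉ (from (∈-decSubset dec) (exceptional-pred (to (∈-decSubset dec) t∈) a))

  toVSet-admissible : ∀ {W₀} → Candidate W₀ → ∀ x → x ∈ˢ toVSet W₀ → Admissible x
  toVSet-admissible (admissible , _) x x∈ with to ∈-toVSet x∈
  ... | j , j∈W₀ , refl = admissible j j∈W₀

  fromVSet-candidate : ∀ {W} → (∀ x → x ∈ˢ W → Admissible x) → NonemptyS W → Closed n W →
                       Candidate (fromVSet W)
  fromVSet-candidate {W} admissible (x , x∈W) closed =
    (λ i i∈ → admissible (toℕ i) (to ∈-fromVSet i∈)) ,
    (index vx , from ∈-fromVSet (subst (_∈ˢ W) (sym (toℕ-index vx)) x∈W)) ,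
    λ s t s∉ t∈ a → closed (toℕ s) (toℕ t) (proj₁ a) (s∉ ∘ from ∈-fromVSet) (to ∈-fromVSet t∈) a
    where
    vx : Vertex n x
    vx = proj₁ (admissible x x∈W)

  minimalCandidate⇒autonomous : ∀ {W₀} → Candidate W₀ → (∀ W → Candidate W → W ⊆ W₀ → W₀ ⊆ W) →
                                Autonomous n (toVSet W₀)
  minimalCandidate⇒autonomous {W₀} candidate@(_ , (i , i∈W₀) , closed) minimal =
    proj₁ ∘₂ admissible , (toℕ i , from toℕ-∈-toVSet i∈W₀) , closedᵛ , minimalᵛ
    where
    admissible : ∀ x → x ∈ˢ toVSet W₀ → Admissible x
    admissible = toVSet-admissible candidate
    closedᵛ : Closed n (toVSet W₀)
    closedᵛ s t vs s∉ t∈ a with to ∈-toVSet t∈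
    ... | j , j∈W₀ , refl =
      closed (index vs) j
             (λ s∈W₀ → s∉ (subst (_∈ˢ toVSet W₀) (toℕ-index vs) (from toℕ-∈-toVSet s∈W₀)))
             j∈W₀ (subst (λ s → Arc n s (toℕ j)) (sym (toℕ-index vs)) a)
    minimalᵛ : ∀ W → InV n W → NonemptyS W → Closed n W → W ⊆ˢ toVSet W₀ → toVSet W₀ ⊆ˢ W
    minimalᵛ W _ nonempty closedW W⊆W₀ y y∈ with to ∈-toVSet y∈
    ... | j , j∈W₀ , refl = to ∈-fromVSet (minimal (fromVSet W)
            (fromVSet-candidate (λ x → admissible x ∘ W⊆W₀ x) nonempty closedW)
            (λ i∈ → to toℕ-∈-toVSet (W⊆W₀ _ (to ∈-fromVSet i∈))) j∈W₀)

  exceptional⇒HasEAC : ∃[ v ] Exceptional v → HasEAC n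
  exceptional⇒HasEAC (_ , ev) with ⊆-minimal Candidate? (proj₂ (exceptional⇒candidate ev))
  ... | W₀ , candidate , minimal =
    toVSet W₀ , autonomous-admissible⇒EAC (minimalCandidate⇒autonomous candidate minimal)
                                          (toVSet-admissible candidate)

theorem4 : (n : ℕ) → 2 ∣ n → 4 ≤ n →
    HasEAC n ⇔ (∃[ v ] (Vertex n v × ¬ Θ n v × ¬ Γ n v × ¬ Ξ n v))
theorem4 n _ _ = mk⇔ (HasEAC⇒exceptional n) (exceptional⇒HasEAC n)
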